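{- Let $k\ge 2$ be an integer and let $D_1,\dots,D_k$ be pairwise vertex-disjoint digraphs. Let $d=\max\{\dim(D_1),\dots,\dim(D_k)\}$. Then $$d\le \dim\Big(\bigcup_{i=1}^k D_i\Big)\le 2\lfloor (d+1)/2\rfloor,$$ where $\bigcup_{i=1}^k D_i$ is the digraph with vertex set $\bigcup_i V(D_i)$ and arc set $\bigcup_i A(D_i)$.
   Context: All digraphs are finite and have simple underlying graphs. For an integer $d\ge 0$ write $[d]=\{1,\dots,d\}$ (with $\mathbb{R}^0=\{0\}$). For $x,y\in\mathbb{R}^d$ let $\mathcal{G}_{x>y}=\{i\in[d]: x_i>y_i\}$. The weak majority relation: $x\succ y$ iff $|\mathcal{G}_{x>y}|-|\mathcal{G}_{y>x}|>0$. A map $f:V(D)\to\mathbb{R}^d$ is an $\mathbb{R}^d$-realizer of $D$ if for all vertices $x,y$: $(x,y)\in A(D)$ iff $f(x)\succ f(y)$. The weak majority dimension $\dim(D)$ is the minimum nonnegative integer $d$ such that $D$ has an $\mathbb{R}^d$-realizer (such $d$ always exists).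
   Formalization: Realizers take values in ℚ^d rather than ℝ^d, so the weak majority dimensions of the digraphs $D_i$ and of their union are taken over rational realizers. -}

module Defs where

open import Data.Nat using (ℕ; zero; suc; _+_; _⊔_)
open import Data.Fin using (Fin; _≟_)
import Data.Fin as F
open import Data.Bool using (Bool; true; false; T; if_then_else_)
open import Data.Product using (Σ; _×_; _,_)
open import Data.Rational using (ℚ; _<_)
open import Data.Rational.Properties using (_<?_)
open import Relation.Nullary using (¬_; yes; no)
open import Relation.Nullary.Decidable using (⌊_⌋)
open import Function.Bundles using (_⇔_)
import Data.Nat as N
import Data.Sum
open import Relation.Binary.PropositionalEquality using (refl)

-- Points of ℚ^d (used in place of ℝ^d), as functions Fin d → ℚ.
Point : ℕ → Set
Point d = Fin d → ℚ

countGt : (d : ℕ) → Point d → Point d → ℕ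
countGt zero    x y = 0
countGt (suc d) x y =
  (if ⌊ y F.zero <? x F.zero ⌋ then 1 else 0) + countGt d (λ i → x (F.suc i)) (λ i → y (F.suc i))

_≻_ : {d : ℕ} → Point d → Point d → Set
_≻_ {d} x y = countGt d y x N.< countGt d x y

-- A finite digraph with simple underlying graph on vertex set Fin size:
-- no loops and no pair of opposite arcs.
record Digraph : Set where
  field
    size  : ℕ
    arc   : Fin size → Fin size → Bool
    irrefl : ∀ x → ¬ T (arc x x)
    asym   : ∀ x y → T (arc x y) → ¬ T (arc y x)
open Digraph public

IsRealizer : (D : Digraph) (d : ℕ) → (Fin (size D) → Point d) → Set
IsRealizer D d f = ∀ x y → (T (arc D x y) ⇔ (f x ≻ f y))

HasRealizer : Digraph → ℕ → Set
HasRealizer D d = Σ (Fin (size D) → Point d) (IsRealizer D d)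

IsDim : Digraph → ℕ → Set
IsDim D d = HasRealizer D d × (∀ e → HasRealizer D e → d N.≤ e)

-- Vertex set of the disjoint union: pairs (i , v) with v a vertex of D_i.
sumSizes : (k : ℕ) → (Fin k → Digraph) → ℕ
sumSizes zero    Ds = 0
sumSizes (suc k) Ds = size (Ds F.zero) + sumSizes k (λ i → Ds (F.suc i))

maxF : (k : ℕ) → (Fin k → ℕ) → ℕ
maxF zero    g = 0
maxF (suc k) g = g F.zero ⊔ maxF k (λ i → g (F.suc i))

locate : (k : ℕ) (Ds : Fin k → Digraph) → Fin (sumSizes k Ds) → Σ (Fin k) (λ i → Fin (size (Ds i)))
locate zero    Ds ()
locate (suc k) Ds u with F.splitAt (size (Ds F.zero)) u
... | Data.Sum.inj₁ v = F.zero , v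
... | Data.Sum.inj₂ w with locate k (λ i → Ds (F.suc i)) w
...   | i , v = F.suc i , v

arcΣ : (k : ℕ) (Ds : Fin k → Digraph) → Σ (Fin k) (λ i → Fin (size (Ds i))) → Σ (Fin k) (λ i → Fin (size (Ds i))) → Bool
arcΣ k Ds (i , x) (j , y) with i ≟ j
... | yes refl = arc (Ds i) x y
... | no _     = false

arcΣ-irrefl : (k : ℕ) (Ds : Fin k → Digraph) → ∀ p → ¬ T (arcΣ k Ds p p)
arcΣ-irrefl k Ds (i , x) with i ≟ i
... | yes refl = irrefl (Ds i) x
... | no ne    = λ ()

arcΣ-asym : (k : ℕ) (Ds : Fin k → Digraph) → ∀ p q → T (arcΣ k Ds p q) → ¬ T (arcΣ k Ds q p)
arcΣ-asym k Ds (i , x) (j , y) with i ≟ j | j ≟ i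
... | yes refl | yes refl = asym (Ds i) x y
... | yes refl | no ne    = λ _ ()
... | no _     | _        = λ ()

-- The union ⋃ D_i of pairwise vertex-disjoint digraphs (modelled as the disjoint union):
-- vertices = ⋃ V(D_i), arcs = ⋃ A(D_i).
⋃D : (k : ℕ) → (Fin k → Digraph) → Digraph
⋃D k Ds = record
  { size   = sumSizes k Ds
  ; arc    = λ u w → arcΣ k Ds (locate k Ds u) (locate k Ds w)
  ; irrefl = λ u → arcΣ-irrefl k Ds (locate k Ds u)
  ; asym   = λ u w → arcΣ-asym k Ds (locate k Ds u) (locate k Ds w)
  }

{-# OPTIONS --safe #-}
module Submission where

-- A realizer of the union restricts to a realizer of each Dᵢ, which gives the lower bound.
-- For the upper bound, realize every Dᵢ in ℚ^(m+m) with m = ⌈d/2⌉ and translate the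
-- points of Dᵢ by i·W on the first m coordinates and by (k − i)·W on the last m, where W
-- exceeds every difference of two coordinates. Inside a component the translation changes
-- no comparison; across components i < j the points of Dᵢ lose every coordinate of the
-- first half and win every coordinate of the second, so the vote ties m to m and no arc
-- appears.

open import Defs
open import Data.Nat using (ℕ; zero; suc; z≤n; s≤s; _≤_; _<_; _*_; _+_; _∸_; _≤′_; ≤′-refl; ≤′-step)
import Data.Nat.Properties as ℕ
open import Data.Nat.DivMod using (_/_; _%_; m≡m%n+[m/n]*n; m%n<n)
open import Data.Fin using (Fin; toℕ; _↑ˡ_; _↑ʳ_; combine; remQuot; _≟_)
import Data.Fin as F
open import Data.Fin.Properties using (splitAt-↑ˡ; splitAt-↑ʳ; remQuot-combine; toℕ≤n; <-cmp)
open import Data.Vec.Functional using (_∷_; tail; take; drop; replicate; _++_; zipWith)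
open import Data.Vec.Functional.Properties using (lookup-++ˡ; lookup-++ʳ)
open import Data.Product using (_×_; _,_; Σ; ∃-syntax; proj₁; proj₂; uncurry)
open import Data.Bool using (T)
open import Data.Rational as ℚ using (ℚ; 0ℚ; 1ℚ)
import Data.Rational.Properties as ℚ
open import Data.Rational.Solver using (module +-*-Solver)
open import Algebra.Definitions.RawMonoid ℚ.+-0-rawMonoid using () renaming (_×_ to _·_)
open import Relation.Nullary using (¬_; yes; no; contradiction)
open import Relation.Binary.Definitions using (tri<; tri≈; tri>)
open import Relation.Binary.PropositionalEquality
  using (_≡_; refl; sym; trans; cong; cong₂; subst; subst₂; module ≡-Reasoning)
open import Function using (_∘_; id)
open import Function.Bundles using (_⇔_; mk⇔; Equivalence)
import Function.Properties.Equivalence as ⇔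

private
  variable
    d k m n : ℕ

countGt-cong : {x y x′ y′ : Point d} → (∀ c → (y c ℚ.< x c) ⇔ (y′ c ℚ.< x′ c)) →
               countGt d x y ≡ countGt d x′ y′
countGt-cong {zero}  _ = refl
countGt-cong {suc d} {x} {y} {x′} {y′} iff with y F.zero ℚ.<? x F.zero | y′ F.zero ℚ.<? x′ F.zero
... | yes _    | yes _     = cong suc (countGt-cong (iff ∘ F.suc))
... | no _     | no _      = countGt-cong (iff ∘ F.suc)
... | yes y<x  | no y′≮x′  = contradiction (Equivalence.to (iff F.zero) y<x) y′≮x′
... | no y≮x   | yes y′<x′ = contradiction (Equivalence.from (iff F.zero) y′<x′) y≮x

countGt-all : {x y : Point d} → (∀ c → y c ℚ.< x c) → countGt d x y ≡ d
countGt-all {zero}          _   = refl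
countGt-all {suc d} {x} {y} y<x with y F.zero ℚ.<? x F.zero
... | yes _  = cong suc (countGt-all (y<x ∘ F.suc))
... | no y≮x = contradiction (y<x F.zero) y≮x

countGt-none : {x y : Point d} → (∀ c → x c ℚ.< y c) → countGt d x y ≡ 0
countGt-none {zero}          _   = refl
countGt-none {suc d} {x} {y} x<y with y F.zero ℚ.<? x F.zero
... | yes y<x = contradiction y<x (ℚ.<-asym (x<y F.zero))
... | no _    = countGt-none (x<y ∘ F.suc)

countGt-++ : ∀ m {n} (x y : Point (m + n)) →
             countGt (m + n) x y ≡ countGt m (take m x) (take m y) + countGt n (drop m x) (drop m y)
countGt-++ zero    x y = refl
countGt-++ (suc m) x y with y F.zero ℚ.<? x F.zero
... | yes _ = cong suc (countGt-++ m (tail x) (tail y))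
... | no _  = countGt-++ m (tail x) (tail y)

crossed⇒incomparable : {x y : Point (m + m)} →
                       (∀ c → take m x c ℚ.< take m y c) → (∀ c → drop m y c ℚ.< drop m x c) →
                       ¬ (x ≻ y) × ¬ (y ≻ x)
crossed⇒incomparable {m} {x} {y} first second = ℕ.<-irrefl balanced , ℕ.<-irrefl (sym balanced)
  where
  open ≡-Reasoning
  balanced : countGt (m + m) y x ≡ countGt (m + m) x y
  balanced = begin
    countGt (m + m) y x
      ≡⟨ countGt-++ m y x ⟩
    countGt m (take m y) (take m x) + countGt m (drop m y) (drop m x)
      ≡⟨ cong₂ _+_ (countGt-all first) (countGt-none second) ⟩
    m + 0
      ≡⟨ ℕ.+-comm m 0 ⟩
    0 + m
      ≡⟨ cong₂ _+_ (countGt-none first) (countGt-all second) ⟨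
    countGt m (take m x) (take m y) + countGt m (drop m x) (drop m y)
      ≡⟨ countGt-++ m x y ⟨
    countGt (m + m) x y ∎

+-cancelʳ-< : ∀ r {p q} → p ℚ.+ r ℚ.< q ℚ.+ r → p ℚ.< q
+-cancelʳ-< r {p} {q} p+r<q+r with p ℚ.<? q
... | yes p<q = p<q
... | no p≮q  = contradiction (ℚ.<-≤-trans p+r<q+r (ℚ.+-monoˡ-≤ r (ℚ.≮⇒≥ p≮q))) (ℚ.<-irrefl refl)

≻-translate : (x y t : Point d) → (x ≻ y) ⇔ (zipWith ℚ._+_ x t ≻ zipWith ℚ._+_ y t)
≻-translate x y t = mk⇔ (subst₂ _<_ (sym (translate y x)) (sym (translate x y)))
                        (subst₂ _<_ (translate y x) (translate x y))
  where
  translate : ∀ x y → countGt _ (zipWith ℚ._+_ x t) (zipWith ℚ._+_ y t) ≡ countGt _ x y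
  translate x y = countGt-cong (λ c → mk⇔ (+-cancelʳ-< (t c)) (ℚ.+-monoˡ-< (t c)))

-- The new coordinate is a tie, so countGt is unchanged by definition.
HasRealizer-suc : (D : Digraph) → HasRealizer D d → HasRealizer D (suc d)
HasRealizer-suc D (f , f-realizes) = (λ v → 0ℚ ∷ f v) , f-realizes

HasRealizer-mono : (D : Digraph) → m ≤ n → HasRealizer D m → HasRealizer D n
HasRealizer-mono D m≤n = go (ℕ.≤⇒≤′ m≤n)
  where
  go : ∀ {m n} → m ≤′ n → HasRealizer D m → HasRealizer D n
  go ≤′-refl        = id
  go (≤′-step m≤′n) = HasRealizer-suc D ∘ go m≤′n

inject : (Ds : Fin k → Digraph) (i : Fin k) → Fin (size (Ds i)) → Fin (size (⋃D k Ds))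
inject {suc k} Ds F.zero    x = x ↑ˡ sumSizes k (Ds ∘ F.suc)
inject {suc k} Ds (F.suc i) x = size (Ds F.zero) ↑ʳ inject (Ds ∘ F.suc) i x

locate-inject : (Ds : Fin k → Digraph) (i : Fin k) (x : Fin (size (Ds i))) → locate k Ds (inject Ds i x) ≡ (i , x)
locate-inject {suc k} Ds F.zero x
  rewrite splitAt-↑ˡ (size (Ds F.zero)) x (sumSizes k (Ds ∘ F.suc)) = refl
locate-inject {suc k} Ds (F.suc i) x
  rewrite splitAt-↑ʳ (size (Ds F.zero)) (sumSizes k (Ds ∘ F.suc)) (inject (Ds ∘ F.suc) i x)
        | locate-inject (Ds ∘ F.suc) i x = refl

arc-inject : (Ds : Fin k → Digraph) (i : Fin k) (x y : Fin (size (Ds i))) →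
             arc (⋃D k Ds) (inject Ds i x) (inject Ds i y) ≡ arc (Ds i) x y
arc-inject {k} Ds i x y rewrite locate-inject Ds i x | locate-inject Ds i y with i ≟ i
... | yes refl = refl
... | no i≢i   = contradiction refl i≢i

HasRealizer-restrict : (Ds : Fin k → Digraph) (i : Fin k) → HasRealizer (⋃D k Ds) d → HasRealizer (Ds i) d
HasRealizer-restrict Ds i (f , f-realizes) =
  f ∘ inject Ds i , λ x y →
    subst (λ b → T b ⇔ (f (inject Ds i x) ≻ f (inject Ds i y))) (arc-inject Ds i x y) (f-realizes _ _)

boundedAbove : (h : Fin n → ℚ) → ∃[ U ] (∀ i → h i ℚ.≤ U)
boundedAbove {zero}  h = 0ℚ , λ ()
boundedAbove {suc n} h = h F.zero ℚ.⊔ U , h≤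
  where
  U : ℚ
  U = proj₁ (boundedAbove (tail h))
  h≤ : ∀ i → h i ℚ.≤ h F.zero ℚ.⊔ U
  h≤ F.zero    = ℚ.p≤p⊔q (h F.zero) U
  h≤ (F.suc i) = ℚ.≤-trans (proj₂ (boundedAbove (tail h)) i) (ℚ.p≤q⊔p (h F.zero) U)

boundedBelow : (h : Fin n → ℚ) → ∃[ L ] (∀ i → L ℚ.≤ h i)
boundedBelow {zero}  h = 0ℚ , λ ()
boundedBelow {suc n} h = h F.zero ℚ.⊓ L , ≤h
  where
  L : ℚ
  L = proj₁ (boundedBelow (tail h))
  ≤h : ∀ i → h F.zero ℚ.⊓ L ℚ.≤ h i
  ≤h F.zero    = ℚ.p⊓q≤p (h F.zero) L
  ≤h (F.suc i) = ℚ.≤-trans (ℚ.p⊓q≤q (h F.zero) L) (proj₂ (boundedBelow (tail h)) i)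

-- Taking W ⊔ 0 keeps W nonnegative also for the empty family.
finite-spread : (h : Fin n → ℚ) → ∃[ W ] (0ℚ ℚ.≤ W × (∀ i j → h i ℚ.< h j ℚ.+ W))
finite-spread h = W ℚ.⊔ 0ℚ , ℚ.p≤q⊔p W 0ℚ , h<h+W
  where
  U L W : ℚ
  U = proj₁ (boundedAbove h)
  L = proj₁ (boundedBelow h)
  W = (1ℚ ℚ.+ U) ℚ.- L
  L+W≡1+U : L ℚ.+ W ≡ 1ℚ ℚ.+ U
  L+W≡1+U = solve 2 (λ l u → l :+ ((con 1ℚ :+ u) :- l) := con 1ℚ :+ u) refl L U
    where open +-*-Solver
  U<1+U : U ℚ.< 1ℚ ℚ.+ U
  U<1+U = subst (ℚ._< 1ℚ ℚ.+ U) (ℚ.+-identityˡ U) (ℚ.+-monoˡ-< U (ℚ.positive⁻¹ 1ℚ))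
  h<h+W : ∀ i j → h i ℚ.< h j ℚ.+ (W ℚ.⊔ 0ℚ)
  h<h+W i j = begin-strict
    h i                     ≤⟨ proj₂ (boundedAbove h) i ⟩
    U                       <⟨ U<1+U ⟩
    1ℚ ℚ.+ U                ≡⟨ L+W≡1+U ⟨
    L ℚ.+ W                 ≤⟨ ℚ.+-monoˡ-≤ W (proj₂ (boundedBelow h) j) ⟩
    h j ℚ.+ W               ≤⟨ ℚ.+-monoʳ-≤ (h j) (ℚ.p≤p⊔q W 0ℚ) ⟩
    h j ℚ.+ (W ℚ.⊔ 0ℚ)      ∎
    where open ℚ.≤-Reasoning

components-spread : (Ds : Fin k → Digraph) (f : ∀ i → Fin (size (Ds i)) → Point d) →
                    ∃[ W ] (0ℚ ℚ.≤ W × (∀ {i j} x y c → f i x c ℚ.< f j y c ℚ.+ W))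
components-spread {k} {d} Ds f =
  let W , 0≤W , v<v+W = finite-spread value
  in W , 0≤W , λ x y c → subst₂ ℚ._<_ (value-combine x c) (cong (ℚ._+ W) (value-combine y c)) (v<v+W _ _)
  where
  vertexValue : Fin (size (⋃D k Ds)) → Fin d → ℚ
  vertexValue u = uncurry f (locate k Ds u)
  value : Fin (size (⋃D k Ds) * d) → ℚ
  value = uncurry vertexValue ∘ remQuot d
  value-combine : ∀ {i} x c → value (combine (inject Ds i x) c) ≡ f i x c
  value-combine {i} x c = trans (cong (uncurry vertexValue) (remQuot-combine (inject Ds i x) c))
                                (cong (λ p → uncurry f p c) (locate-inject Ds i x))

·-nonNeg : ∀ {W} → 0ℚ ℚ.≤ W → ∀ n → 0ℚ ℚ.≤ n · W
·-nonNeg 0≤W zero    = ℚ.≤-refl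
·-nonNeg 0≤W (suc n) = ℚ.+-mono-≤ 0≤W (·-nonNeg 0≤W n)

·-monoˡ-≤ : ∀ {W} → 0ℚ ℚ.≤ W → m ≤ n → m · W ℚ.≤ n · W
·-monoˡ-≤ 0≤W (z≤n {n}) = ·-nonNeg 0≤W n
·-monoˡ-≤ {W = W} 0≤W (s≤s m≤n) = ℚ.+-monoʳ-≤ W (·-monoˡ-≤ 0≤W m≤n)

stagger : ∀ a b {W} → 0ℚ ℚ.≤ W → a ℚ.< b ℚ.+ W → m < n → a ℚ.+ m · W ℚ.< b ℚ.+ n · W
stagger {m} {n} a b {W} 0≤W a<b+W m<n = begin-strict
  a ℚ.+ m · W          <⟨ ℚ.+-monoˡ-< (m · W) a<b+W ⟩
  (b ℚ.+ W) ℚ.+ m · W  ≡⟨ ℚ.+-assoc b W (m · W) ⟩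
  b ℚ.+ suc m · W      ≤⟨ ℚ.+-monoʳ-≤ b (·-monoˡ-≤ 0≤W m<n) ⟩
  b ℚ.+ n · W          ∎
  where open ℚ.≤-Reasoning

module DisjointUnion {k m : ℕ} (Ds : Fin k → Digraph) (f : ∀ i → Fin (size (Ds i)) → Point (m + m))
                     (f-realizes : ∀ i → IsRealizer (Ds i) (m + m) (f i))
                     {W : ℚ} (0≤W : 0ℚ ℚ.≤ W) (spread : ∀ {i j} x y c → f i x c ℚ.< f j y c ℚ.+ W) where

  offset : Fin k → Point (m + m)
  offset i = replicate m (toℕ i · W) ++ replicate m ((k ∸ toℕ i) · W)

  offset-↑ˡ : ∀ i c → offset i (c ↑ˡ m) ≡ toℕ i · W
  offset-↑ˡ i = lookup-++ˡ (replicate m (toℕ i · W)) (replicate m ((k ∸ toℕ i) · W))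

  offset-↑ʳ : ∀ i c → offset i (m ↑ʳ c) ≡ (k ∸ toℕ i) · W
  offset-↑ʳ i = lookup-++ʳ (replicate m (toℕ i · W)) (replicate m ((k ∸ toℕ i) · W))

  place : Σ (Fin k) (λ i → Fin (size (Ds i))) → Point (m + m)
  place (i , x) = zipWith ℚ._+_ (f i x) (offset i)

  place-incomparable : ∀ {i j} x y → toℕ i < toℕ j →
                       ¬ (place (i , x) ≻ place (j , y)) × ¬ (place (j , y) ≻ place (i , x))
  place-incomparable {i} {j} x y i<j = crossed⇒incomparable first second
    where
    open ℚ.≤-Reasoning
    first : ∀ c → take m (place (i , x)) c ℚ.< take m (place (j , y)) c
    first c = begin-strict
      a ℚ.+ offset i (c ↑ˡ m) ≡⟨ cong (a ℚ.+_) (offset-↑ˡ i c) ⟩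
      a ℚ.+ toℕ i · W         <⟨ stagger a b 0≤W (spread x y (c ↑ˡ m)) i<j ⟩
      b ℚ.+ toℕ j · W         ≡⟨ cong (b ℚ.+_) (offset-↑ˡ j c) ⟨
      b ℚ.+ offset j (c ↑ˡ m) ∎
      where
      a b : ℚ
      a = f i x (c ↑ˡ m)
      b = f j y (c ↑ˡ m)
    second : ∀ c → drop m (place (j , y)) c ℚ.< drop m (place (i , x)) c
    second c = begin-strict
      b ℚ.+ offset j (m ↑ʳ c) ≡⟨ cong (b ℚ.+_) (offset-↑ʳ j c) ⟩
      b ℚ.+ (k ∸ toℕ j) · W   <⟨ stagger b a 0≤W (spread y x (m ↑ʳ c)) (ℕ.∸-monoʳ-< i<j (toℕ≤n j)) ⟩
      a ℚ.+ (k ∸ toℕ i) · W   ≡⟨ cong (a ℚ.+_) (offset-↑ʳ i c) ⟨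
      a ℚ.+ offset i (m ↑ʳ c) ∎
      where
      a b : ℚ
      a = f i x (m ↑ʳ c)
      b = f j y (m ↑ʳ c)

  place-realizes : ∀ p q → T (arcΣ k Ds p q) ⇔ (place p ≻ place q)
  place-realizes (i , x) (j , y) with i ≟ j
  ... | yes refl = ⇔.trans (f-realizes i x y) (≻-translate (f i x) (f i y) (offset i))
  ... | no i≢j with <-cmp i j
  ...   | tri< i<j _ _ = mk⇔ (λ ()) (proj₁ (place-incomparable x y i<j))
  ...   | tri≈ _ i≡j _ = contradiction i≡j i≢j
  ...   | tri> _ _ j<i = mk⇔ (λ ()) (proj₂ (place-incomparable y x j<i))

  realizer : HasRealizer (⋃D k Ds) (m + m)
  realizer = place ∘ locate k Ds , λ u w → place-realizes (locate k Ds u) (locate k Ds w)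

HasRealizer-⋃D : (Ds : Fin k → Digraph) → (∀ i → HasRealizer (Ds i) (m + m)) → HasRealizer (⋃D k Ds) (m + m)
HasRealizer-⋃D {m = m} Ds realizers =
  let _ , 0≤W , W-spread = components-spread Ds (proj₁ ∘ realizers)
  in DisjointUnion.realizer {m = m} Ds (proj₁ ∘ realizers) (proj₂ ∘ realizers) 0≤W W-spread

≤maxF : (g : Fin k → ℕ) (i : Fin k) → g i ≤ maxF k g
≤maxF g F.zero    = ℕ.m≤m⊔n _ _
≤maxF g (F.suc i) = ℕ.m≤n⇒m≤o⊔n (g F.zero) (≤maxF (g ∘ F.suc) i)

maxF-lub : (g : Fin k → ℕ) → (∀ i → g i ≤ n) → maxF k g ≤ n
maxF-lub {zero}  g _   = z≤n
maxF-lub {suc k} g g≤n = ℕ.⊔-lub (g≤n F.zero) (maxF-lub (g ∘ F.suc) (g≤n ∘ F.suc))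

n≤[n+1]/2+[n+1]/2 : ∀ n → n ≤ (n + 1) / 2 + (n + 1) / 2
n≤[n+1]/2+[n+1]/2 n = ℕ.≤-pred (begin
  suc n                ≡⟨ ℕ.+-comm 1 n ⟩
  n + 1                ≡⟨ m≡m%n+[m/n]*n (n + 1) 2 ⟩
  (n + 1) % 2 + q * 2  ≤⟨ ℕ.+-monoˡ-≤ (q * 2) (ℕ.≤-pred (m%n<n (n + 1) 2)) ⟩
  1 + q * 2            ≡⟨ cong suc (ℕ.*-comm q 2) ⟩
  1 + 2 * q            ≡⟨ cong (λ r → suc (q + r)) (ℕ.+-identityʳ q) ⟩
  suc (q + q)          ∎)
  where
  open ℕ.≤-Reasoning
  q : ℕ
  q = (n + 1) / 2

proposition2p5 : (k : ℕ) → 2 ≤ k → (Ds : Fin k → Digraph) → (dims : Fin k → ℕ) → (∀ i → IsDim (Ds i) (dims i)) → (e : ℕ) → IsDim (⋃D k Ds) e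
    → (maxF k dims ≤ e) × (e ≤ 2 * ((maxF k dims + 1) / 2))
-- The bounds hold for every k.
proposition2p5 k _ Ds dims dims-isDim e (union-realizer , e-least) = lower , upper
  where
  dmax half : ℕ
  dmax = maxF k dims
  half = (dmax + 1) / 2
  lower : dmax ≤ e
  lower = maxF-lub dims (λ i → proj₂ (dims-isDim i) e (HasRealizer-restrict Ds i union-realizer))
  padded : ∀ i → HasRealizer (Ds i) (half + half)
  padded i = HasRealizer-mono (Ds i) (ℕ.≤-trans (≤maxF dims i) (n≤[n+1]/2+[n+1]/2 dmax)) (proj₁ (dims-isDim i))
  upper : e ≤ 2 * half
  upper = subst (e ≤_) (cong (half +_) (sym (ℕ.+-identityʳ half))) (e-least (half + half) (HasRealizer-⋃D {m = half} Ds padded))
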